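{- Let $L$ and $U$ be disjoint finite lattices, each of length at least $3$, such that $L$ has exactly two coatoms and $U$ has exactly two atoms, and let $S_1$ and $S_2$ be their two vertical 2-sums. Then $S_1$ and $S_2$ are nonisomorphic if and only if $L$ has fixed coatoms and $U$ has fixed atoms.
   Context: Vertical 2-sum: if $L$ has coatoms $c_1,c_2$ and $U$ has atoms $a_1,a_2$, the two vertical 2-sums of $L$ and $U$ are the lattices obtained by removing the top $1_L$ of $L$ and the bottom $0_U$ of $U$ and identifying $(c_1,c_2)$ with either $(a_1,a_2)$ or $(a_2,a_1)$ (the order on the result is the union of the orders of $L\setminus\{1_L\}$ and $U\setminus\{0_U\}$, transitively closed). If a lattice has exactly two coatoms [atoms], they are called symmetric if the lattice has an automorphism that swaps them, and fixed otherwise. -}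

module Defs where

open import Data.Nat using (ℕ)
open import Data.Fin using (Fin)
open import Data.Fin.Properties using (all?)
open import Data.Product using (Σ; _×_; _,_; ∃; ∃-syntax; proj₁)
open import Data.Sum using (_⊎_; inj₁; inj₂)
open import Data.Empty using (⊥)
open import Data.Fin.Properties using (_≟_)
open import Relation.Binary.Core using (Rel)
open import Relation.Binary.Definitions using (Decidable)
open import Relation.Binary.PropositionalEquality using (_≡_; _≢_)
open import Relation.Binary.Lattice.Structures using (IsLattice)
open import Relation.Binary.Construct.Closure.Transitive using (TransClosure)
open import Relation.Nullary using (¬_; Dec)
open import Relation.Nullary.Decidable using (False)
open import Function.Bundles using (_↔_; Inverse; _⇔_)

record FinLattice : Set₁ where
  field
    size    : ℕ
    _≤_     : Rel (Fin size) _
    _≤?_    : Decidable _≤_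
    _∨_     : Fin size → Fin size → Fin size
    _∧_     : Fin size → Fin size → Fin size
    isLattice : IsLattice _≡_ _≤_ _∨_ _∧_

module _ (L : FinLattice) where
  open FinLattice L

  Elt : Set
  Elt = Fin size

  _<_ : Elt → Elt → Set
  x < y = x ≤ y × x ≢ y

  IsTop : Elt → Set
  IsTop x = ∀ y → y ≤ x

  IsBot : Elt → Set
  IsBot x = ∀ y → x ≤ y

  isTop? : ∀ x → Dec (IsTop x)
  isTop? x = all? (λ y → y ≤? x)

  isBot? : ∀ x → Dec (IsBot x)
  isBot? x = all? (λ y → x ≤? y)

  IsAtom : Elt → Set
  IsAtom a = ¬ IsBot a × (∀ x → x < a → IsBot x)

  IsCoatom : Elt → Set
  IsCoatom c = ¬ IsTop c × (∀ x → c < x → IsTop x)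

  LengthAtLeast3 : Set
  LengthAtLeast3 = ∃[ x₀ ] ∃[ x₁ ] ∃[ x₂ ] ∃[ x₃ ] (x₀ < x₁ × x₁ < x₂ × x₂ < x₃)

  ExactlyTwoCoatoms : Elt → Elt → Set
  ExactlyTwoCoatoms c₁ c₂ =
    c₁ ≢ c₂ × IsCoatom c₁ × IsCoatom c₂ × (∀ c → IsCoatom c → c ≡ c₁ ⊎ c ≡ c₂)

  ExactlyTwoAtoms : Elt → Elt → Set
  ExactlyTwoAtoms a₁ a₂ =
    a₁ ≢ a₂ × IsAtom a₁ × IsAtom a₂ × (∀ a → IsAtom a → a ≡ a₁ ⊎ a ≡ a₂)

  Automorphism : Set
  Automorphism = Σ (Elt ↔ Elt) λ f →
    ∀ x y → (x ≤ y) ⇔ (Inverse.to f x ≤ Inverse.to f y)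

  Symmetric : Elt → Elt → Set
  Symmetric u v = Σ Automorphism λ φ →
    Inverse.to (proj₁ φ) u ≡ v × Inverse.to (proj₁ φ) v ≡ u

  Fixed : Elt → Elt → Set
  Fixed u v = ¬ Symmetric u v

-- Vertical 2-sum of L and U, identifying coatom c₁ of L with atom a₁ of U
-- and c₂ with a₂.  Carrier: (L ∖ {1_L}) ⊎ (U ∖ {0_U, a₁, a₂}); the identified
-- elements c₁ = a₁, c₂ = a₂ are represented by c₁, c₂ in the left summand.
module VSum (L U : FinLattice) (c₁ c₂ : Elt L) (a₁ a₂ : Elt U) where
  module L = FinLattice L
  module U = FinLattice U

  Carrier : Set
  Carrier = Σ (Elt L) (λ x → False (isTop? L x))
          ⊎ Σ (Elt U) (λ y → False (isBot? U y) × False (y ≟ a₁) × False (y ≟ a₂))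

  RepL : Carrier → Elt L → Set
  RepL (inj₁ (y , _)) x = x ≡ y
  RepL (inj₂ _)       x = ⊥

  RepU : Carrier → Elt U → Set
  RepU (inj₁ (x , _)) u = (x ≡ c₁ × u ≡ a₁) ⊎ (x ≡ c₂ × u ≡ a₂)
  RepU (inj₂ (v , _)) u = u ≡ v

  Union : Rel Carrier _
  Union p q = (∃[ x ] ∃[ y ] (RepL p x × RepL q y × x L.≤ y))
            ⊎ (∃[ u ] ∃[ v ] (RepU p u × RepU q v × u U.≤ v))

  _≤_ : Rel Carrier _
  _≤_ = TransClosure Union

_≅_ : ∀ {A B : Set} → Rel A _ → Rel B _ → Set
_≅_ {A} {B} _≤A_ _≤B_ = Σ (A ↔ B) λ f →
  ∀ x y → (x ≤A y) ⇔ (Inverse.to f x ≤B Inverse.to f y)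

module Submission where

-- In either 2-sum every element is comparable to one of the two junctions (the identified
-- coatom-atom pairs); below junction k lies a copy of the down-set of c_k in L, above it a copy
-- of the up-set of the corresponding atom in U.  An isomorphism cannot move a junction strictly
-- into such a copy of the same finite size (pigeonhole), so it maps junctions to junctions.
-- If it swaps them, it restricts to an automorphism of L without its top, which extends to an
-- automorphism of L swapping c₁ and c₂; if it fixes them, it restricts in the same way to an
-- automorphism of U swapping a₁ and a₂, as the atoms are listed in opposite orders in the two
-- sums.  Conversely, such an automorphism of L or of U, combined with the identity on the
-- other summand, is an isomorphism of the two sums.

open import Defs
open import Data.Product using (_×_)
open import Function.Bundles using (_⇔_)
open import Relation.Nullary using (¬_)

open import Level using (0ℓ)
open import Data.Nat using (suc)
import Data.Nat.Properties as ℕ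
open import Data.Fin using (Fin; punchOut)
open import Data.Fin.Properties using (any?; _≟_; punchOut-injective; injective⇒≤)
open import Data.Fin.Induction using (po-noetherian)
open import Data.Bool.Properties using (T-irrelevant)
open import Data.Product using (Σ; _,_; ∃-syntax; proj₁; proj₂)
open import Data.Sum as Sum using (_⊎_; inj₁; inj₂)
open import Data.Empty using (⊥; ⊥-elim)
open import Data.Unit using (tt)
open import Function.Base using (flip; _∘_)
open import Function.Construct.Symmetry using (⇔-sym)
open import Function.Bundles using (Inverse; Equivalence; mk⇔; mk↔ₛ′)
open import Induction.WellFounded using (Acc; acc)
open import Relation.Binary.Construct.Closure.Transitive using ([_]; _∷_)
open import Relation.Binary.Core using (Rel)
open import Relation.Binary.Definitions using (Transitive)
open import Relation.Binary.Structures using (IsPartialOrder)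
open import Relation.Binary.Lattice.Structures using (IsLattice)
open import Relation.Binary.Lattice.Properties.Lattice using (∧-∨-isLattice)
open import Relation.Binary.PropositionalEquality
  using (_≡_; _≢_; refl; sym; trans; cong; subst; subst₂; ≢-sym; module ≡-Reasoning)
open import Relation.Nullary using (Dec; yes; no)
open import Relation.Nullary.Decidable
  using (False; fromWitnessFalse; toWitnessFalse; decidable-stable; _×-dec_; ¬?)
open import Relation.Unary using (Pred; Decidable)

record _≃_ {A B : Set} (_≤A_ : Rel A 0ℓ) (_≤B_ : Rel B 0ℓ) : Set where
  field
    to      : A → B
    from    : B → A
    from-to : ∀ x → from (to x) ≡ x
    to-from : ∀ y → to (from y) ≡ y
    mono    : ∀ {x y} → x ≤A y → to x ≤B to y
    reflect : ∀ {x y} → to x ≤B to y → x ≤A y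

  to-injective : ∀ {x y} → to x ≡ to y → x ≡ y
  to-injective {x} {y} e = trans (sym (from-to x)) (trans (cong from e) (from-to y))

  from≡⇒to≡ : ∀ {x y} → from y ≡ x → to x ≡ y
  from≡⇒to≡ {y = y} refl = to-from y

  to≡⇒from≡ : ∀ {x y} → to x ≡ y → from y ≡ x
  to≡⇒from≡ {x} refl = from-to x

  from-mono : ∀ {x y} → x ≤B y → from x ≤A from y
  from-mono {x} {y} x≤y = reflect (subst₂ _≤B_ (sym (to-from x)) (sym (to-from y)) x≤y)

open _≃_

module _ {A B : Set} {_≤A_ : Rel A 0ℓ} {_≤B_ : Rel B 0ℓ} where

  mk≃ : (F : A → B) (G : B → A) → (∀ x → G (F x) ≡ x) → (∀ y → F (G y) ≡ y) →
        (∀ {x y} → x ≤A y → F x ≤B F y) → (∀ {x y} → x ≤B y → G x ≤A G y) →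
        _≤A_ ≃ _≤B_
  mk≃ F G GF FG F-mono G-mono = record
    { to = F ; from = G ; from-to = GF ; to-from = FG ; mono = F-mono
    ; reflect = λ {x} {y} Fx≤Fy → subst₂ _≤A_ (GF x) (GF y) (G-mono Fx≤Fy) }

  ≅⇒≃ : _≤A_ ≅ _≤B_ → _≤A_ ≃ _≤B_
  ≅⇒≃ (f , f-iso) = record
    { to = Inverse.to f ; from = Inverse.from f
    ; from-to = Inverse.strictlyInverseʳ f ; to-from = Inverse.strictlyInverseˡ f
    ; mono = Equivalence.to (f-iso _ _) ; reflect = Equivalence.from (f-iso _ _) }

  ≃⇒≅ : _≤A_ ≃ _≤B_ → _≤A_ ≅ _≤B_
  ≃⇒≅ f = mk↔ₛ′ (to f) (from f) (to-from f) (from-to f) , λ x y → mk⇔ (mono f) (reflect f)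

≃-refl : ∀ {A : Set} {_≤_ : Rel A 0ℓ} → _≤_ ≃ _≤_
≃-refl = record
  { to = λ x → x ; from = λ x → x ; from-to = λ _ → refl ; to-from = λ _ → refl
  ; mono = λ x≤y → x≤y ; reflect = λ x≤y → x≤y }

module _ {A B : Set} {_≤A_ : Rel A 0ℓ} {_≤B_ : Rel B 0ℓ} where

  ≃-sym : _≤A_ ≃ _≤B_ → _≤B_ ≃ _≤A_
  ≃-sym f = mk≃ (from f) (to f) (to-from f) (from-to f) (from-mono f) (mono f)

  ≃-flip : _≤A_ ≃ _≤B_ → flip _≤A_ ≃ flip _≤B_
  ≃-flip f = record
    { to = to f ; from = from f ; from-to = from-to f ; to-from = to-from f
    ; mono = mono f ; reflect = reflect f }

  ≃-cong : {_≤A'_ : Rel A 0ℓ} {_≤B'_ : Rel B 0ℓ} →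
           (∀ {x y} → (x ≤A y) ⇔ (x ≤A' y)) → (∀ {x y} → (x ≤B y) ⇔ (x ≤B' y)) →
           _≤A_ ≃ _≤B_ → _≤A'_ ≃ _≤B'_
  ≃-cong A⇔A' B⇔B' f = record
    { to = to f ; from = from f ; from-to = from-to f ; to-from = to-from f
    ; mono = Equivalence.to B⇔B' ∘ mono f ∘ Equivalence.from A⇔A'
    ; reflect = Equivalence.to A⇔A' ∘ reflect f ∘ Equivalence.from B⇔B' }

injectiveOn⇒surjectiveOn : ∀ {n} {P : Pred (Fin n) 0ℓ} → Decidable P → (g : Fin n → Fin n) →
  (∀ {x} → P x → P (g x)) → (∀ {x y} → P x → P y → g x ≡ g y → x ≡ y) →
  ∀ {z} → P z → ∃[ x ] P x × g x ≡ z
injectiveOn⇒surjectiveOn {suc m} {P} P? g g-closed g-injective {z} Pz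
  with any? (λ x → P? x ×-dec (g x ≟ z))
... | yes hit = hit
... | no miss = ⊥-elim (ℕ.1+n≰n (injective⇒≤ h-injective))
  where
  -- g extended by the identity off P is injective and misses z; punching out z
  -- then gives an injection Fin (suc m) → Fin m.
  G′ : ∀ x → Dec (P x) → Fin (suc m)
  G′ x (yes _) = g x
  G′ x (no _)  = x

  G : Fin (suc m) → Fin (suc m)
  G x = G′ x (P? x)

  G≢z : ∀ x → z ≢ G x
  G≢z x with P? x
  ... | yes Px = λ z≡gx → miss (x , Px , sym z≡gx)
  ... | no ¬Px = λ { refl → ¬Px Pz }

  G-injective : ∀ {x y} → G x ≡ G y → x ≡ y
  G-injective {x} {y} with P? x | P? y
  ... | yes Px | yes Py = g-injective Px Py
  ... | yes Px | no ¬Py = λ { refl → ⊥-elim (¬Py (g-closed Px)) }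
  ... | no ¬Px | yes Py = λ { refl → ⊥-elim (¬Px (g-closed Py)) }
  ... | no _   | no _   = λ x≡y → x≡y

  h : Fin (suc m) → Fin m
  h x = punchOut (G≢z x)

  h-injective : ∀ {x y} → h x ≡ h y → x ≡ y
  h-injective {x} {y} = G-injective ∘ punchOut-injective (G≢z x) (G≢z y)

_ᵒᵖ : FinLattice → FinLattice
K ᵒᵖ = record
  { size = size ; _≤_ = flip _≤_ ; _≤?_ = flip _≤?_ ; _∨_ = _∧_ ; _∧_ = _∨_
  ; isLattice = ∧-∨-isLattice (record { isLattice = isLattice }) }
  where open FinLattice K

module _ (K : FinLattice) where

  atom⇒coatomᵒᵖ : ∀ {a} → IsAtom K a → IsCoatom (K ᵒᵖ) a
  atom⇒coatomᵒᵖ (¬bot , minimal) = ¬bot , λ x (x≤a , a≢x) → minimal x (x≤a , ≢-sym a≢x)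

  coatomᵒᵖ⇒atom : ∀ {a} → IsCoatom (K ᵒᵖ) a → IsAtom K a
  coatomᵒᵖ⇒atom (¬bot , minimal) = ¬bot , λ x (x≤a , x≢a) → minimal x (x≤a , ≢-sym x≢a)

  twoAtoms⇒twoCoatomsᵒᵖ : ∀ {a₁ a₂} → ExactlyTwoAtoms K a₁ a₂ → ExactlyTwoCoatoms (K ᵒᵖ) a₁ a₂
  twoAtoms⇒twoCoatomsᵒᵖ (a₁≢a₂ , atom₁ , atom₂ , only) =
    a₁≢a₂ , atom⇒coatomᵒᵖ atom₁ , atom⇒coatomᵒᵖ atom₂ , λ a → only a ∘ coatomᵒᵖ⇒atom

  swapAtoms : ∀ {a₁ a₂} → ExactlyTwoAtoms K a₁ a₂ → ExactlyTwoAtoms K a₂ a₁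
  swapAtoms (a₁≢a₂ , atom₁ , atom₂ , only) =
    ≢-sym a₁≢a₂ , atom₂ , atom₁ , λ a → Sum.swap ∘ only a

isPartialOrder : (K : FinLattice) → IsPartialOrder _≡_ (FinLattice._≤_ K)
isPartialOrder K = IsLattice.isPartialOrder (FinLattice.isLattice K)

module _ (K : FinLattice) where
  open FinLattice K
  open IsPartialOrder (isPartialOrder K) using () renaming (refl to ≤-refl; trans to ≤-trans)

  top-upward : ∀ {x y} → IsTop K x → x ≤ y → IsTop K y
  top-upward x-top x≤y z = ≤-trans (x-top z) x≤y

  coatom-maximal : ∀ {c x} → IsCoatom K c → c ≤ x → ¬ IsTop K x → x ≡ c
  coatom-maximal {c} {x} (_ , covered) c≤x ¬top with x ≟ c
  ... | yes x≡c = x≡c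
  ... | no x≢c = ⊥-elim (¬top (covered x (c≤x , ≢-sym x≢c)))

  below-coatom : ∀ {x} → ¬ IsTop K x → ∃[ c ] IsCoatom K c × x ≤ c
  below-coatom {x} ¬top = go ¬top (po-noetherian (isPartialOrder K) x)
    where
    _<?_ : ∀ x y → Dec (_<_ K x y)
    x <? y = (x ≤? y) ×-dec ¬? (x ≟ y)

    go : ∀ {x} → ¬ IsTop K x → Acc (flip (_<_ K)) x → ∃[ c ] IsCoatom K c × x ≤ c
    go {x} ¬top (acc above) with any? (λ y → (x <? y) ×-dec ¬? (isTop? K y))
    ... | yes (y , x<y , ¬top-y) =
      let c , coatom , y≤c = go ¬top-y (above x<y) in c , coatom , ≤-trans (proj₁ x<y) y≤c
    ... | no none = x , (¬top , covered) , ≤-refl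
      where
      covered : ∀ y → _<_ K x y → IsTop K y
      covered y x<y = decidable-stable (isTop? K y) (λ ¬top-y → none (y , x<y , ¬top-y))

automorphism-reflects-top : ∀ K (φ : FinLattice._≤_ K ≃ FinLattice._≤_ K) {x} →
                            IsTop K (to φ x) → IsTop K x
automorphism-reflects-top K φ top y = reflect φ (top (to φ y))

module _ (K : FinLattice) where
  open FinLattice K

  extendOverTop : (Elt K → Elt K) → Elt K → Elt K
  extendOverTop g x with isTop? K x
  ... | yes _ = x
  ... | no _  = g x

  extendOverTop-top : ∀ g {x} → IsTop K x → extendOverTop g x ≡ x
  extendOverTop-top g {x} x-top with isTop? K x
  ... | yes _ = refl
  ... | no ¬top = ⊥-elim (¬top x-top)

  extendOverTop-nonTop : ∀ g {x} → ¬ IsTop K x → extendOverTop g x ≡ g x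
  extendOverTop-nonTop g {x} ¬top with isTop? K x
  ... | yes x-top = ⊥-elim (¬top x-top)
  ... | no _ = refl

  extendOverTop-inverse : ∀ {g h} → (∀ {x} → ¬ IsTop K x → ¬ IsTop K (g x)) →
    (∀ {x} → ¬ IsTop K x → h (g x) ≡ x) → ∀ x → extendOverTop h (extendOverTop g x) ≡ x
  extendOverTop-inverse {g} {h} g-nonTop hg x with isTop? K x
  ... | yes x-top = extendOverTop-top h x-top
  ... | no ¬top = trans (extendOverTop-nonTop h (g-nonTop ¬top)) (hg ¬top)

  extendOverTop-mono : ∀ {g} → (∀ {x y} → ¬ IsTop K x → ¬ IsTop K y → x ≤ y → g x ≤ g y) →
    ∀ {x y} → x ≤ y → extendOverTop g x ≤ extendOverTop g y
  extendOverTop-mono {g} g-mono {x} {y} x≤y with isTop? K y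
  ... | yes y-top = y-top (extendOverTop g x)
  ... | no ¬top-y = subst (_≤ g y) (sym (extendOverTop-nonTop g ¬top-x)) (g-mono ¬top-x ¬top-y x≤y)
    where
    ¬top-x : ¬ IsTop K x
    ¬top-x x-top = ¬top-y (top-upward K x-top x≤y)

-- A chart exhibits K without its top as the subset Domain of another order,
-- with embed and project restricting to mutually inverse order isomorphisms.
record Chart (K : FinLattice) {C : Set} (_⊑_ : Rel C 0ℓ) : Set₁ where
  open FinLattice K
  field
    Domain         : Pred C 0ℓ
    embed          : Elt K → C
    project        : C → Elt K
    embed-domain   : ∀ {x} → ¬ IsTop K x → Domain (embed x)
    project-nonTop : ∀ {p} → Domain p → ¬ IsTop K (project p)
    project-embed  : ∀ {x} → ¬ IsTop K x → project (embed x) ≡ x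
    embed-project  : ∀ {p} → Domain p → embed (project p) ≡ p
    embed-≤⇔       : ∀ {x y} → ¬ IsTop K x → ¬ IsTop K y → (x ≤ y) ⇔ (embed x ⊑ embed y)

  embed-injective : ∀ {x y} → ¬ IsTop K x → ¬ IsTop K y → embed x ≡ embed y → x ≡ y
  embed-injective ¬top-x ¬top-y e =
    trans (sym (project-embed ¬top-x)) (trans (cong project e) (project-embed ¬top-y))

module ChartMap {K : FinLattice} {C C' : Set} {_⊑_ : Rel C 0ℓ} {_⊑'_ : Rel C' 0ℓ}
                (χ : Chart K _⊑_) (χ' : Chart K _⊑'_) (f : _⊑_ ≃ _⊑'_) where
  open FinLattice K
  open IsPartialOrder (isPartialOrder K) using () renaming (antisym to ≤-antisym)
  module χ = Chart χ
  module χ' = Chart χ'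

  transfer : Elt K → Elt K
  transfer x = χ'.project (to f (χ.embed x))

  module _ (f-domain : ∀ {p} → χ.Domain p → χ'.Domain (to f p)) where

    embed-transfer : ∀ {x} → ¬ IsTop K x → χ'.embed (transfer x) ≡ to f (χ.embed x)
    embed-transfer ¬top = χ'.embed-project (f-domain (χ.embed-domain ¬top))

    transfer-nonTop : ∀ {x} → ¬ IsTop K x → ¬ IsTop K (transfer x)
    transfer-nonTop ¬top = χ'.project-nonTop (f-domain (χ.embed-domain ¬top))

    transfer-mono : ∀ {x y} → ¬ IsTop K x → ¬ IsTop K y → x ≤ y → transfer x ≤ transfer y
    transfer-mono ¬top-x ¬top-y x≤y =
      Equivalence.from (χ'.embed-≤⇔ (transfer-nonTop ¬top-x) (transfer-nonTop ¬top-y))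
        (subst₂ _⊑'_ (sym (embed-transfer ¬top-x)) (sym (embed-transfer ¬top-y))
          (mono f (Equivalence.to (χ.embed-≤⇔ ¬top-x ¬top-y) x≤y)))

  -- transfer maps the down-set of k injectively into itself, so by pigeonhole it hits k.
  image-below-counterpart⇒≡ : Transitive _⊑'_ → ∀ {k} → ¬ IsTop K k →
    (∀ {q} → q ⊑' χ'.embed k → χ'.Domain q) →
    to f (χ.embed k) ⊑' χ'.embed k → to f (χ.embed k) ≡ χ'.embed k
  image-below-counterpart⇒≡ ⊑'-trans {k} ¬top-k below-domain fk⊑k =
    let x , x≤k , x↦k = injectiveOn⇒surjectiveOn (_≤? k) transfer transfer-closed transfer-injective
                          (IsPartialOrder.refl (isPartialOrder K))
        fx≡k = trans (sym (embed-transfer′ x≤k)) (cong χ'.embed x↦k)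
        k≤x = Equivalence.from (χ.embed-≤⇔ ¬top-k (nonTop x≤k))
                (reflect f (subst (to f (χ.embed k) ⊑'_) (sym fx≡k) fk⊑k))
    in trans (cong (to f ∘ χ.embed) (≤-antisym k≤x x≤k)) fx≡k
    where
    nonTop : ∀ {x} → x ≤ k → ¬ IsTop K x
    nonTop x≤k x-top = ¬top-k (top-upward K x-top x≤k)

    image-below : ∀ {x} → x ≤ k → to f (χ.embed x) ⊑' χ'.embed k
    image-below x≤k = ⊑'-trans (mono f (Equivalence.to (χ.embed-≤⇔ (nonTop x≤k) ¬top-k) x≤k)) fk⊑k

    embed-transfer′ : ∀ {x} → x ≤ k → χ'.embed (transfer x) ≡ to f (χ.embed x)
    embed-transfer′ x≤k = χ'.embed-project (below-domain (image-below x≤k))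

    transfer-closed : ∀ {x} → x ≤ k → transfer x ≤ k
    transfer-closed x≤k =
      Equivalence.from (χ'.embed-≤⇔ (χ'.project-nonTop (below-domain (image-below x≤k))) ¬top-k)
        (subst (_⊑' χ'.embed k) (sym (embed-transfer′ x≤k)) (image-below x≤k))

    transfer-injective : ∀ {x y} → x ≤ k → y ≤ k → transfer x ≡ transfer y → x ≡ y
    transfer-injective x≤k y≤k e = χ.embed-injective (nonTop x≤k) (nonTop y≤k) (to-injective f
      (trans (sym (embed-transfer′ x≤k)) (trans (cong χ'.embed e) (embed-transfer′ y≤k))))

chart-automorphism : ∀ {K C C' _⊑_ _⊑'_} (χ : Chart K {C} _⊑_) (χ' : Chart K {C'} _⊑'_) →
  (f : _⊑_ ≃ _⊑'_) →
  (∀ {p} → Chart.Domain χ p → Chart.Domain χ' (to f p)) →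
  (∀ {q} → Chart.Domain χ' q → Chart.Domain χ (from f q)) →
  Σ (FinLattice._≤_ K ≃ FinLattice._≤_ K) λ φ →
    ∀ {x} → ¬ IsTop K x → to φ x ≡ Chart.project χ' (to f (Chart.embed χ x))
chart-automorphism {K} χ χ' f f-domain f⁻-domain =
  mk≃ (extendOverTop K F.transfer) (extendOverTop K G.transfer)
      (extendOverTop-inverse K (F.transfer-nonTop f-domain) G∘F)
      (extendOverTop-inverse K (G.transfer-nonTop f⁻-domain) F∘G)
      (extendOverTop-mono K (F.transfer-mono f-domain))
      (extendOverTop-mono K (G.transfer-mono f⁻-domain))
  , extendOverTop-nonTop K F.transfer
  where
  module F = ChartMap χ χ' f
  module G = ChartMap χ' χ (≃-sym f)

  G∘F : ∀ {x} → ¬ IsTop K x → G.transfer (F.transfer x) ≡ x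
  G∘F {x} ¬top = begin
    Chart.project χ (from f (Chart.embed χ' (F.transfer x)))
      ≡⟨ cong (Chart.project χ ∘ from f) (F.embed-transfer f-domain ¬top) ⟩
    Chart.project χ (from f (to f (Chart.embed χ x)))
      ≡⟨ cong (Chart.project χ) (from-to f _) ⟩
    Chart.project χ (Chart.embed χ x)
      ≡⟨ Chart.project-embed χ ¬top ⟩
    x ∎
    where open ≡-Reasoning

  F∘G : ∀ {y} → ¬ IsTop K y → F.transfer (G.transfer y) ≡ y
  F∘G {y} ¬top = begin
    Chart.project χ' (to f (Chart.embed χ (G.transfer y)))
      ≡⟨ cong (Chart.project χ' ∘ to f) (G.embed-transfer f⁻-domain ¬top) ⟩
    Chart.project χ' (to f (from f (Chart.embed χ' y)))
      ≡⟨ cong (Chart.project χ') (to-from f _) ⟩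
    Chart.project χ' (Chart.embed χ' y)
      ≡⟨ Chart.project-embed χ' ¬top ⟩
    y ∎
    where open ≡-Reasoning

data Index : Set where
  ι₁ ι₂ : Index

swap : Index → Index
swap ι₁ = ι₂
swap ι₂ = ι₁

swap-involutive : ∀ k → swap (swap k) ≡ k
swap-involutive ι₁ = refl
swap-involutive ι₂ = refl

≡⊎≡swap : ∀ i m → m ≡ i ⊎ m ≡ swap i
≡⊎≡swap ι₁ ι₁ = inj₁ refl
≡⊎≡swap ι₁ ι₂ = inj₂ refl
≡⊎≡swap ι₂ ι₁ = inj₂ refl
≡⊎≡swap ι₂ ι₂ = inj₁ refl

module TwoCoatoms (K : FinLattice) {c₁ c₂ : Elt K} (hc : ExactlyTwoCoatoms K c₁ c₂) where
  open FinLattice K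

  c : Index → Elt K
  c ι₁ = c₁
  c ι₂ = c₂

  c-coatom : ∀ k → IsCoatom K (c k)
  c-coatom ι₁ = proj₁ (proj₂ hc)
  c-coatom ι₂ = proj₁ (proj₂ (proj₂ hc))

  c-nonTop : ∀ k → ¬ IsTop K (c k)
  c-nonTop k = proj₁ (c-coatom k)

  below-c : ∀ {x} → ¬ IsTop K x → ∃[ k ] x ≤ c k
  below-c ¬top with below-coatom K ¬top
  ... | d , d-coatom , x≤d with proj₂ (proj₂ (proj₂ hc)) d d-coatom
  ... | inj₁ refl = ι₁ , x≤d
  ... | inj₂ refl = ι₂ , x≤d

  below-c⇒nonTop : ∀ {x} k → x ≤ c k → ¬ IsTop K x
  below-c⇒nonTop k x≤c x-top = c-nonTop k (top-upward K x-top x≤c)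

  c-maximal : ∀ k {x} → c k ≤ x → ¬ IsTop K x → x ≡ c k
  c-maximal k = coatom-maximal K (c-coatom k)

  c-injective : ∀ {k k'} → c k ≡ c k' → k ≡ k'
  c-injective {ι₁} {ι₁} _ = refl
  c-injective {ι₁} {ι₂} e = ⊥-elim (proj₁ hc e)
  c-injective {ι₂} {ι₁} e = ⊥-elim (proj₁ hc (sym e))
  c-injective {ι₂} {ι₂} _ = refl

  c-incomparable : ∀ {k k'} → c k ≤ c k' → k ≡ k'
  c-incomparable {k} {k'} ck≤ck' = c-injective (sym (c-maximal k ck≤ck' (c-nonTop k')))

module TwoSum (L U : FinLattice) {c₁ c₂ : Elt L} (hc : ExactlyTwoCoatoms L c₁ c₂)
              {b₁ b₂ : Elt U} (hb : ExactlyTwoAtoms U b₁ b₂) where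
  module L = FinLattice L
  module U = FinLattice U
  module L≤ = IsPartialOrder (isPartialOrder L)
  module U≤ = IsPartialOrder (isPartialOrder U)
  module Lc = TwoCoatoms L hc
  module Ua = TwoCoatoms (U ᵒᵖ) (twoAtoms⇒twoCoatomsᵒᵖ U hb)
  open VSum L U c₁ c₂ b₁ b₂ public using (Carrier)
  open VSum L U c₁ c₂ b₁ b₂ using (RepU; Union) renaming (_≤_ to _≤ˢ_)
  open Lc public using (c)
  open Ua public using () renaming (c to b)

  UpperProof : Elt U → Set
  UpperProof v = False (isBot? U v) × False (v ≟ b₁) × False (v ≟ b₂)

  inj₁-cong : ∀ {x y} {px : False (isTop? L x)} {py : False (isTop? L y)} →
              x ≡ y → _≡_ {A = Carrier} (inj₁ (x , px)) (inj₁ (y , py))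
  inj₁-cong refl = cong (λ px → inj₁ (_ , px)) (T-irrelevant _ _)

  inj₂-cong : ∀ {u v} {pu : UpperProof u} {pv : UpperProof v} →
              u ≡ v → _≡_ {A = Carrier} (inj₂ (u , pu)) (inj₂ (v , pv))
  inj₂-cong {pu = pu₁ , pu₂ , pu₃} {pv₁ , pv₂ , pv₃} refl
    rewrite T-irrelevant pu₁ pv₁ | T-irrelevant pu₂ pv₂ | T-irrelevant pu₃ pv₃ = refl

  junction : Index → Carrier
  junction k = inj₁ (c k , fromWitnessFalse (Lc.c-nonTop k))

  -- An element of L lies below an element of U exactly when it passes through a junction.
  _⊑_ : Rel Carrier 0ℓ
  inj₁ (x , _) ⊑ inj₁ (y , _) = x L.≤ y
  inj₁ (x , _) ⊑ inj₂ (v , _) = ∃[ k ] x L.≤ c k × b k U.≤ v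
  inj₂ _       ⊑ inj₁ _       = ⊥
  inj₂ (u , _) ⊑ inj₂ (v , _) = u U.≤ v

  ⊑-refl : ∀ {p} → p ⊑ p
  ⊑-refl {inj₁ _} = L≤.refl
  ⊑-refl {inj₂ _} = U≤.refl

  ⊑-trans : Transitive _⊑_
  ⊑-trans {inj₁ _} {inj₁ _} {inj₁ _} x≤y y≤z = L≤.trans x≤y y≤z
  ⊑-trans {inj₁ _} {inj₁ _} {inj₂ _} x≤y (k , y≤c , b≤v) = k , L≤.trans x≤y y≤c , b≤v
  ⊑-trans {inj₁ _} {inj₂ _} {inj₂ _} (k , x≤c , b≤u) u≤v = k , x≤c , U≤.trans b≤u u≤v
  ⊑-trans {inj₂ _} {inj₂ _} {inj₂ _} u≤v v≤w = U≤.trans u≤v v≤w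

  union⇒⊑ : ∀ {p q} → Union p q → p ⊑ q
  union⇒⊑ {inj₁ _} {inj₁ _} (inj₁ (_ , _ , refl , refl , x≤y)) = x≤y
  union⇒⊑ {inj₁ _} {inj₂ _} (inj₁ (_ , _ , _ , () , _))
  union⇒⊑ {inj₂ _} (inj₁ (_ , _ , () , _))
  union⇒⊑ {inj₁ _} {inj₁ _} (inj₂ (_ , _ , ru , rv , u≤v)) = lemma ru rv u≤v
    where
    lemma : ∀ {x y u v} → (x ≡ c₁ × u ≡ b₁) ⊎ (x ≡ c₂ × u ≡ b₂) →
            (y ≡ c₁ × v ≡ b₁) ⊎ (y ≡ c₂ × v ≡ b₂) → u U.≤ v → x L.≤ y
    lemma (inj₁ (refl , refl)) (inj₁ (refl , refl)) _ = L≤.refl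
    lemma (inj₂ (refl , refl)) (inj₂ (refl , refl)) _ = L≤.refl
    lemma (inj₁ (refl , refl)) (inj₂ (refl , refl)) b₁≤b₂ with () ← Ua.c-incomparable {ι₂} {ι₁} b₁≤b₂
    lemma (inj₂ (refl , refl)) (inj₁ (refl , refl)) b₂≤b₁ with () ← Ua.c-incomparable {ι₁} {ι₂} b₂≤b₁
  union⇒⊑ {inj₁ _} {inj₂ _} (inj₂ (_ , _ , inj₁ (refl , refl) , refl , b≤v)) = ι₁ , L≤.refl , b≤v
  union⇒⊑ {inj₁ _} {inj₂ _} (inj₂ (_ , _ , inj₂ (refl , refl) , refl , b≤v)) = ι₂ , L≤.refl , b≤v
  union⇒⊑ {inj₂ (u , ¬bot , u≢b₁ , u≢b₂)} {inj₁ _} (inj₂ (_ , _ , refl , rv , u≤v)) = lemma rv u≤v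
    where
    -- a non-bottom element below an atom is that atom, which u is not
    lemma : ∀ {y v} → (y ≡ c₁ × v ≡ b₁) ⊎ (y ≡ c₂ × v ≡ b₂) → u U.≤ v → ⊥
    lemma (inj₁ (refl , refl)) u≤b₁ = toWitnessFalse u≢b₁ (Ua.c-maximal ι₁ u≤b₁ (toWitnessFalse ¬bot))
    lemma (inj₂ (refl , refl)) u≤b₂ = toWitnessFalse u≢b₂ (Ua.c-maximal ι₂ u≤b₂ (toWitnessFalse ¬bot))
  union⇒⊑ {inj₂ _} {inj₂ _} (inj₂ (_ , _ , refl , refl , u≤v)) = u≤v

  ⊑⇒≤ˢ : ∀ {p q} → p ⊑ q → p ≤ˢ q
  ⊑⇒≤ˢ {inj₁ _} {inj₁ _} x≤y = [ inj₁ (_ , _ , refl , refl , x≤y) ]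
  ⊑⇒≤ˢ {inj₁ _} {inj₂ _} (k , x≤c , b≤v) =
    _∷_ {y = junction k} (inj₁ (_ , _ , refl , refl , x≤c)) [ inj₂ (_ , _ , junction-RepU k , refl , b≤v) ]
    where
    junction-RepU : ∀ k → RepU (junction k) (b k)
    junction-RepU ι₁ = inj₁ (refl , refl)
    junction-RepU ι₂ = inj₂ (refl , refl)
  ⊑⇒≤ˢ {inj₂ _} {inj₂ _} u≤v = [ inj₂ (_ , _ , refl , refl , u≤v) ]

  ≤ˢ⇔⊑ : ∀ {p q} → (p ≤ˢ q) ⇔ (p ⊑ q)
  ≤ˢ⇔⊑ = mk⇔ ≤ˢ⇒⊑ ⊑⇒≤ˢ
    where
    ≤ˢ⇒⊑ : ∀ {p q} → p ≤ˢ q → p ⊑ q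
    ≤ˢ⇒⊑ [ p∪q ] = union⇒⊑ p∪q
    ≤ˢ⇒⊑ {p} {r} (_∷_ {y = q} p∪q q≤r) = ⊑-trans {p} {q} {r} (union⇒⊑ p∪q) (≤ˢ⇒⊑ q≤r)

  comparable-junction : ∀ p → ∃[ k ] (p ⊑ junction k ⊎ junction k ⊑ p)
  comparable-junction (inj₁ (x , ¬top)) =
    let k , x≤c = Lc.below-c (toWitnessFalse ¬top) in k , inj₁ x≤c
  comparable-junction (inj₂ (v , ¬bot , _)) =
    let k , b≤v = Ua.below-c (toWitnessFalse ¬bot) in k , inj₂ (k , L≤.refl , b≤v)

  -- The top of L is not represented; it is sent to the junk value junction ι₁.
  lowerEmbed′ : ∀ x → Dec (IsTop L x) → Carrier
  lowerEmbed′ x (yes _)   = junction ι₁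
  lowerEmbed′ x (no ¬top) = inj₁ (x , fromWitnessFalse ¬top)

  lowerEmbed : Elt L → Carrier
  lowerEmbed x = lowerEmbed′ x (isTop? L x)

  lowerEmbed-nonTop : ∀ {x} (¬top : False (isTop? L x)) → lowerEmbed x ≡ inj₁ (x , ¬top)
  lowerEmbed-nonTop {x} ¬top = lemma (isTop? L x)
    where
    lemma : ∀ d → lowerEmbed′ x d ≡ inj₁ (x , ¬top)
    lemma (yes top) = ⊥-elim (toWitnessFalse ¬top top)
    lemma (no _)    = inj₁-cong refl

  lowerProject : Carrier → Elt L
  lowerProject (inj₁ (x , _)) = x
  lowerProject (inj₂ _)       = c₁

  lowerChart : Chart L _⊑_
  lowerChart = record
    { Domain         = λ p → ∃[ k ] p ⊑ junction k
    ; embed          = lowerEmbed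
    ; project        = lowerProject
    ; embed-domain   = embed-domain
    ; project-nonTop = λ {p} → project-nonTop {p}
    ; project-embed  = λ ¬top → cong lowerProject (lowerEmbed-nonTop (fromWitnessFalse ¬top))
    ; embed-project  = λ {p} → embed-project {p}
    ; embed-≤⇔       = embed-≤⇔
    }
    where
    embed-domain : ∀ {x} → ¬ IsTop L x → ∃[ k ] lowerEmbed x ⊑ junction k
    embed-domain ¬top rewrite lowerEmbed-nonTop (fromWitnessFalse ¬top) = Lc.below-c ¬top

    project-nonTop : ∀ {p} → ∃[ k ] p ⊑ junction k → ¬ IsTop L (lowerProject p)
    project-nonTop {inj₁ (_ , ¬top)} _ = toWitnessFalse ¬top

    embed-project : ∀ {p} → ∃[ k ] p ⊑ junction k → lowerEmbed (lowerProject p) ≡ p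
    embed-project {inj₁ (_ , ¬top)} _ = lowerEmbed-nonTop ¬top

    embed-≤⇔ : ∀ {x y} → ¬ IsTop L x → ¬ IsTop L y → (x L.≤ y) ⇔ (lowerEmbed x ⊑ lowerEmbed y)
    embed-≤⇔ ¬top-x ¬top-y
      rewrite lowerEmbed-nonTop (fromWitnessFalse ¬top-x) | lowerEmbed-nonTop (fromWitnessFalse ¬top-y)
      = mk⇔ (λ x≤y → x≤y) (λ x≤y → x≤y)

  lowerEmbed-c : ∀ k → lowerEmbed (c k) ≡ junction k
  lowerEmbed-c k = lowerEmbed-nonTop _

  -- The bottom of U is not represented; it is sent to the junk value junction ι₁.
  upperEmbed′ : ∀ v → Dec (v ≡ b₁) → Dec (v ≡ b₂) → Dec (IsBot U v) → Carrier
  upperEmbed′ v (yes _)    _          _         = junction ι₁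
  upperEmbed′ v (no _)     (yes _)    _         = junction ι₂
  upperEmbed′ v (no v≢b₁) (no v≢b₂) (no ¬bot) =
    inj₂ (v , fromWitnessFalse ¬bot , fromWitnessFalse v≢b₁ , fromWitnessFalse v≢b₂)
  upperEmbed′ v (no _)     (no _)     (yes _)   = junction ι₁

  upperEmbed : Elt U → Carrier
  upperEmbed v = upperEmbed′ v (v ≟ b₁) (v ≟ b₂) (isBot? U v)

  upperEmbed-b : ∀ k → upperEmbed (b k) ≡ junction k
  upperEmbed-b ι₁ with b₁ ≟ b₁
  ... | yes _    = refl
  ... | no b₁≢b₁ = ⊥-elim (b₁≢b₁ refl)
  upperEmbed-b ι₂ with b₂ ≟ b₁ | b₂ ≟ b₂
  ... | yes b₂≡b₁ | _        = ⊥-elim (proj₁ hb (sym b₂≡b₁))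
  ... | no _      | yes _    = refl
  ... | no _      | no b₂≢b₂ = ⊥-elim (b₂≢b₂ refl)

  upperEmbed-inj₂ : ∀ {v} (pv : UpperProof v) → upperEmbed v ≡ inj₂ (v , pv)
  upperEmbed-inj₂ {v} pv@(¬bot , v≢b₁ , v≢b₂) = lemma (v ≟ b₁) (v ≟ b₂) (isBot? U v)
    where
    lemma : ∀ d₁ d₂ d → upperEmbed′ v d₁ d₂ d ≡ inj₂ (v , pv)
    lemma (yes v≡b₁) _          _         = ⊥-elim (toWitnessFalse v≢b₁ v≡b₁)
    lemma (no _)     (yes v≡b₂) _         = ⊥-elim (toWitnessFalse v≢b₂ v≡b₂)
    lemma (no _)     (no _)     (no _)    = inj₂-cong refl
    lemma (no _)     (no _)     (yes bot) = ⊥-elim (toWitnessFalse ¬bot bot)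

  atom⊎upperProof : ∀ {v} → ¬ IsBot U v → (∃[ k ] v ≡ b k) ⊎ UpperProof v
  atom⊎upperProof {v} ¬bot with v ≟ b₁ | v ≟ b₂
  ... | yes v≡b₁ | _         = inj₁ (ι₁ , v≡b₁)
  ... | no _     | yes v≡b₂  = inj₁ (ι₂ , v≡b₂)
  ... | no _      | no _      = inj₂ (fromWitnessFalse ¬bot , tt , tt)

  upperProject : Carrier → Elt U
  upperProject (inj₁ (x , _)) with x ≟ c₁
  ... | yes _ = b₁
  ... | no _  = b₂
  upperProject (inj₂ (v , _)) = v

  upperProject-junction : ∀ k → upperProject (junction k) ≡ b k
  upperProject-junction ι₁ with c₁ ≟ c₁
  ... | yes _    = refl
  ... | no c₁≢c₁ = ⊥-elim (c₁≢c₁ refl)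
  upperProject-junction ι₂ with c₂ ≟ c₁
  ... | yes c₂≡c₁ = ⊥-elim (proj₁ hc (sym c₂≡c₁))
  ... | no _      = refl

  above-junction : ∀ {k p} → junction k ⊑ p →
                   p ≡ junction k ⊎ ∃[ v ] Σ (UpperProof v) λ pv → p ≡ inj₂ (v , pv)
  above-junction {k} {inj₁ (x , ¬top)} c≤x = inj₁ (inj₁-cong (Lc.c-maximal k c≤x (toWitnessFalse ¬top)))
  above-junction {k} {inj₂ (v , pv)}   _   = inj₂ (v , pv , refl)

  b-below-upperProject : ∀ {k p} → junction k ⊑ p → b k U.≤ upperProject p
  b-below-upperProject {k} {p} w⊑p with above-junction {k} {p} w⊑p
  ... | inj₁ refl = subst (b k U.≤_) (sym (upperProject-junction k)) U≤.refl
  ... | inj₂ (v , pv , refl) with m , c≤c , b≤v ← w⊑p with refl ← Lc.c-incomparable {k} {m} c≤c = b≤v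

  junction-⊑-upperEmbed : ∀ {k v} → b k U.≤ v → junction k ⊑ upperEmbed v
  junction-⊑-upperEmbed {k} {v} b≤v with atom⊎upperProof (Ua.below-c⇒nonTop k b≤v)
  ... | inj₁ (m , refl) with refl ← Ua.c-incomparable {m} {k} b≤v
    = subst (junction k ⊑_) (sym (upperEmbed-b k)) (⊑-refl {junction k})
  ... | inj₂ pv = subst (junction k ⊑_) (sym (upperEmbed-inj₂ pv)) (k , L≤.refl , b≤v)

  upperProject-mono : ∀ {k m p q} → junction k ⊑ p → junction m ⊑ q → p ⊑ q →
                      upperProject p U.≤ upperProject q
  upperProject-mono {k} {m} {p} {q} w⊑p w⊑q p⊑q with above-junction {k} {p} w⊑p | above-junction {m} {q} w⊑q
  ... | inj₁ refl | inj₁ refl with refl ← Lc.c-incomparable {k} {m} p⊑q = U≤.refl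
  ... | inj₁ refl | inj₂ (v , pv , refl) with n , c≤c , b≤v ← p⊑q with refl ← Lc.c-incomparable {k} {n} c≤c
    = subst (U._≤ v) (sym (upperProject-junction k)) b≤v
  ... | inj₂ (u , pu , refl) | inj₁ refl = ⊥-elim p⊑q
  ... | inj₂ (u , pu , refl) | inj₂ (v , pv , refl) = p⊑q

  upperEmbed-mono : ∀ {u v} → ¬ IsBot U u → u U.≤ v → upperEmbed u ⊑ upperEmbed v
  upperEmbed-mono {u} {v} ¬bot-u u≤v with atom⊎upperProof ¬bot-u
  ... | inj₁ (k , refl) = subst (_⊑ upperEmbed v) (sym (upperEmbed-b k)) (junction-⊑-upperEmbed u≤v)
  ... | inj₂ pu with atom⊎upperProof {v} (λ bot-v → ¬bot-u (λ x → U≤.trans u≤v (bot-v x)))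
  ...   | inj₁ (m , refl) = ⊥-elim (toWitnessFalse (upperProof-≢ pu m) (Ua.c-maximal m u≤v ¬bot-u))
    where
    upperProof-≢ : ∀ {v} → UpperProof v → ∀ m → False (v ≟ b m)
    upperProof-≢ (_ , v≢b₁ , _) ι₁ = v≢b₁
    upperProof-≢ (_ , _ , v≢b₂) ι₂ = v≢b₂
  ...   | inj₂ pv = subst₂ _⊑_ (sym (upperEmbed-inj₂ pu)) (sym (upperEmbed-inj₂ pv)) u≤v

  upperChart : Chart (U ᵒᵖ) (flip _⊑_)
  upperChart = record
    { Domain         = λ p → ∃[ k ] junction k ⊑ p
    ; embed          = upperEmbed
    ; project        = upperProject
    ; embed-domain   = embed-domain
    ; project-nonTop = λ {p} (k , w⊑p) → Ua.below-c⇒nonTop k (b-below-upperProject {k} {p} w⊑p)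
    ; project-embed  = project-embed
    ; embed-project  = λ {p} → embed-project {p}
    ; embed-≤⇔       = λ ¬bot-v ¬bot-u → upperEmbed-≤⇔ ¬bot-u ¬bot-v
    }
    where
    embed-domain : ∀ {v} → ¬ IsBot U v → ∃[ k ] junction k ⊑ upperEmbed v
    embed-domain ¬bot = let k , b≤v = Ua.below-c ¬bot in k , junction-⊑-upperEmbed b≤v

    project-embed : ∀ {v} → ¬ IsBot U v → upperProject (upperEmbed v) ≡ v
    project-embed ¬bot with atom⊎upperProof ¬bot
    ... | inj₁ (k , refl) = trans (cong upperProject (upperEmbed-b k)) (upperProject-junction k)
    ... | inj₂ pv = cong upperProject (upperEmbed-inj₂ pv)

    embed-project : ∀ {p} → ∃[ k ] junction k ⊑ p → upperEmbed (upperProject p) ≡ p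
    embed-project {p} (k , w⊑p) with above-junction {k} {p} w⊑p
    ... | inj₁ refl = trans (cong upperEmbed (upperProject-junction k)) (upperEmbed-b k)
    ... | inj₂ (v , pv , refl) = upperEmbed-inj₂ pv

    upperEmbed-≤⇔ : ∀ {u v} → ¬ IsBot U u → ¬ IsBot U v → (u U.≤ v) ⇔ (upperEmbed u ⊑ upperEmbed v)
    upperEmbed-≤⇔ {u} {v} ¬bot-u ¬bot-v = mk⇔ (upperEmbed-mono ¬bot-u) λ u⊑v →
      let k , w⊑u = embed-domain ¬bot-u ; m , w⊑v = embed-domain ¬bot-v in
      subst₂ U._≤_ (project-embed ¬bot-u) (project-embed ¬bot-v)
        (upperProject-mono {k} {m} {upperEmbed u} {upperEmbed v} w⊑u w⊑v u⊑v)

module SumIso (L U : FinLattice) {c₁ c₂ : Elt L} (hc : ExactlyTwoCoatoms L c₁ c₂)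
              {b₁ b₂ b₁' b₂' : Elt U} (hb : ExactlyTwoAtoms U b₁ b₂) (hb' : ExactlyTwoAtoms U b₁' b₂')
              (f : TwoSum._⊑_ L U hc hb ≃ TwoSum._⊑_ L U hc hb') where
  module S  = TwoSum L U hc hb
  module S' = TwoSum L U hc hb'

  image-below-junction⇒≡ : ∀ {k} → to f (S.junction k) S'.⊑ S'.junction k →
                           to f (S.junction k) ≡ S'.junction k
  image-below-junction⇒≡ {k} fw⊑w =
    subst₂ _≡_ (cong (to f) (S.lowerEmbed-c k)) (S'.lowerEmbed-c k)
      (ChartMap.image-below-counterpart⇒≡ S.lowerChart S'.lowerChart f
        (λ {p} {q} {r} → S'.⊑-trans {p} {q} {r}) (S.Lc.c-nonTop k)
        (λ {q} q⊑w → k , subst (q S'.⊑_) (S'.lowerEmbed-c k) q⊑w)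
        (subst₂ S'._⊑_ (cong (to f) (sym (S.lowerEmbed-c k))) (sym (S'.lowerEmbed-c k)) fw⊑w))

  image-above-junction⇒≡ : ∀ {i m} → S.b i ≡ S'.b m →
    S'.junction m S'.⊑ to f (S.junction i) → to f (S.junction i) ≡ S'.junction m
  image-above-junction⇒≡ {i} {m} b≡b' w⊑fw =
    subst₂ _≡_ (cong (to f) (S.upperEmbed-b i)) embed'-b
      (ChartMap.image-below-counterpart⇒≡ S.upperChart S'.upperChart (≃-flip f)
        (λ {p} {q} {r} q⊒p r⊒q → S'.⊑-trans {r} {q} {p} r⊒q q⊒p) (S.Ua.c-nonTop i)
        (λ {q} w⊑q → m , subst (S'._⊑ q) embed'-b w⊑q)
        (subst₂ S'._⊑_ (sym embed'-b) (cong (to f) (sym (S.upperEmbed-b i))) w⊑fw))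
    where
    embed'-b : S'.upperEmbed (S.b i) ≡ S'.junction m
    embed'-b = trans (cong S'.upperEmbed b≡b') (S'.upperEmbed-b m)

  lower-domain-preserved : (∀ i → ∃[ m ] to f (S.junction i) ≡ S'.junction m) →
    ∀ {p} → ∃[ k ] p S.⊑ S.junction k → ∃[ m ] to f p S'.⊑ S'.junction m
  lower-domain-preserved preserved {p} (k , p⊑w) =
    let m , fw≡w = preserved k in m , subst (to f p S'.⊑_) fw≡w (mono f p⊑w)

  upper-domain-preserved : (∀ i → ∃[ m ] to f (S.junction i) ≡ S'.junction m) →
    ∀ {p} → ∃[ k ] S.junction k S.⊑ p → ∃[ m ] S'.junction m S'.⊑ to f p
  upper-domain-preserved preserved {p} (k , w⊑p) =
    let m , fw≡w = preserved k in m , subst (S'._⊑ to f p) fw≡w (mono f w⊑p)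

module SumMap (L U : FinLattice) {c₁ c₂ : Elt L} (hc : ExactlyTwoCoatoms L c₁ c₂)
              {b₁ b₂ b₁' b₂' : Elt U} (hb : ExactlyTwoAtoms U b₁ b₂) (hb' : ExactlyTwoAtoms U b₁' b₂')
              (φ : FinLattice._≤_ L ≃ FinLattice._≤_ L) (ψ : FinLattice._≤_ U ≃ FinLattice._≤_ U)
              (τ : Index → Index) (τ-involutive : ∀ k → τ (τ k) ≡ k)
              (φ-c : ∀ k → to φ (TwoSum.c L U hc hb k) ≡ TwoSum.c L U hc hb (τ k))
              (ψ-b : ∀ k → to ψ (TwoSum.b L U hc hb k) ≡ TwoSum.b L U hc hb' (τ k)) where
  module S  = TwoSum L U hc hb
  module S' = TwoSum L U hc hb'

  ψ-avoids-b : ∀ {v} → (∀ k → v ≢ S.b k) → ∀ k → to ψ v ≢ S'.b k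
  ψ-avoids-b v≢b k ψv≡b = v≢b (τ k) (to-injective ψ (begin
    to ψ _              ≡⟨ ψv≡b ⟩
    S'.b k              ≡⟨ cong S'.b (sym (τ-involutive k)) ⟩
    S'.b (τ (τ k))      ≡⟨ sym (ψ-b (τ k)) ⟩
    to ψ (S.b (τ k))    ∎))
    where open ≡-Reasoning

  map : S.Carrier → S'.Carrier
  map (inj₁ (x , ¬top)) = inj₁ (to φ x , fromWitnessFalse (toWitnessFalse ¬top ∘ automorphism-reflects-top L φ))
  map (inj₂ (v , ¬bot , v≢b₁ , v≢b₂)) =
    inj₂ (to ψ v , fromWitnessFalse (toWitnessFalse ¬bot ∘ automorphism-reflects-top (U ᵒᵖ) (≃-flip ψ))
                 , fromWitnessFalse (ψ-avoids-b v≢b ι₁) , fromWitnessFalse (ψ-avoids-b v≢b ι₂))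
    where
    v≢b : ∀ k → v ≢ S.b k
    v≢b ι₁ = toWitnessFalse v≢b₁
    v≢b ι₂ = toWitnessFalse v≢b₂

  map-mono : ∀ {p q} → p S.⊑ q → map p S'.⊑ map q
  map-mono {inj₁ _}       {inj₁ _}       x≤y = mono φ x≤y
  map-mono {inj₁ (x , _)} {inj₂ (v , _)} (k , x≤c , b≤v) =
    τ k , subst (S.L._≤_ (to φ x)) (φ-c k) (mono φ x≤c)
        , subst (λ b' → b' S.U.≤ to ψ v) (ψ-b k) (mono ψ b≤v)
  map-mono {inj₂ _}       {inj₂ _}       u≤v = mono ψ u≤v

module _ (L U : FinLattice) {c₁ c₂ : Elt L} (hc : ExactlyTwoCoatoms L c₁ c₂)
         {b₁ b₂ b₁' b₂' : Elt U} (hb : ExactlyTwoAtoms U b₁ b₂) (hb' : ExactlyTwoAtoms U b₁' b₂') where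
  private
    module S  = TwoSum L U hc hb
    module S' = TwoSum L U hc hb'

  junctions-preserved : (∀ k → S.b k ≡ S'.b (swap k)) → (f : S._⊑_ ≃ S'._⊑_) →
                        ∀ i → ∃[ m ] to f (S.junction i) ≡ S'.junction m
  junctions-preserved b≡b' f i = from-comparable (S'.comparable-junction (to f (S.junction i)))
    where
    module F = SumIso L U hc hb hb' f
    module G = SumIso L U hc hb' hb (≃-sym f)

    from-comparable : ∃[ m ] (to f (S.junction i) S'.⊑ S'.junction m
                              ⊎ S'.junction m S'.⊑ to f (S.junction i)) →
                      ∃[ m ] to f (S.junction i) ≡ S'.junction m
    from-comparable (m , inj₁ fw⊑w) with ≡⊎≡swap i m
    ... | inj₁ refl = m , F.image-below-junction⇒≡ fw⊑w
    ... | inj₂ refl = m , from≡⇒to≡ f (G.image-above-junction⇒≡ (sym (b≡b' i))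
                            (reflect f (subst (to f (S.junction i) S'.⊑_) (sym (to-from f _)) fw⊑w)))
    from-comparable (m , inj₂ w⊑fw) with ≡⊎≡swap i m
    ... | inj₁ refl = m , from≡⇒to≡ f (G.image-below-junction⇒≡
                            (reflect f (subst (S'._⊑ to f (S.junction i)) (sym (to-from f _)) w⊑fw)))
    ... | inj₂ refl = m , F.image-above-junction⇒≡ (b≡b' i) w⊑fw

  lowerAutomorphism : (f : S._⊑_ ≃ S'._⊑_) →
    (∀ i → ∃[ m ] to f (S.junction i) ≡ S'.junction m) →
    (∀ i → ∃[ m ] from f (S'.junction i) ≡ S.junction m) →
    Σ (S.L._≤_ ≃ S.L._≤_) λ φ → ∀ {k m} → to f (S.junction k) ≡ S'.junction m → to φ (S.c k) ≡ S.c m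
  lowerAutomorphism f preserved preserved⁻ = φ , φ-c
    where
    module F = SumIso L U hc hb hb' f
    module G = SumIso L U hc hb' hb (≃-sym f)

    φ-spec : Σ (S.L._≤_ ≃ S.L._≤_) λ φ →
             ∀ {x} → ¬ IsTop L x → to φ x ≡ S'.lowerProject (to f (S.lowerEmbed x))
    φ-spec = chart-automorphism S.lowerChart S'.lowerChart f
               (F.lower-domain-preserved preserved) (G.lower-domain-preserved preserved⁻)
    φ : S.L._≤_ ≃ S.L._≤_
    φ = proj₁ φ-spec

    φ-c : ∀ {k m} → to f (S.junction k) ≡ S'.junction m → to φ (S.c k) ≡ S.c m
    φ-c {k} {m} fw≡w = begin
      to φ (S.c k)                             ≡⟨ proj₂ φ-spec (S.Lc.c-nonTop k) ⟩
      S'.lowerProject (to f (S.lowerEmbed (S.c k))) ≡⟨ cong (S'.lowerProject ∘ to f) (S.lowerEmbed-c k) ⟩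
      S'.lowerProject (to f (S.junction k))   ≡⟨ cong S'.lowerProject fw≡w ⟩
      S.c m                                    ∎
      where open ≡-Reasoning

  upperAutomorphism : (f : S._⊑_ ≃ S'._⊑_) →
    (∀ i → ∃[ m ] to f (S.junction i) ≡ S'.junction m) →
    (∀ i → ∃[ m ] from f (S'.junction i) ≡ S.junction m) →
    Σ (S.U._≤_ ≃ S.U._≤_) λ ψ → ∀ {k m} → to f (S.junction k) ≡ S'.junction m → to ψ (S.b k) ≡ S'.b m
  upperAutomorphism f preserved preserved⁻ = ≃-flip ψ , ψ-b
    where
    module F = SumIso L U hc hb hb' f
    module G = SumIso L U hc hb' hb (≃-sym f)

    ψ-spec : Σ (flip S.U._≤_ ≃ flip S.U._≤_) λ ψ →
             ∀ {v} → ¬ IsBot U v → to ψ v ≡ S'.upperProject (to f (S.upperEmbed v))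
    ψ-spec = chart-automorphism S.upperChart S'.upperChart (≃-flip f)
               (F.upper-domain-preserved preserved) (G.upper-domain-preserved preserved⁻)
    ψ : flip S.U._≤_ ≃ flip S.U._≤_
    ψ = proj₁ ψ-spec

    ψ-b : ∀ {k m} → to f (S.junction k) ≡ S'.junction m → to ψ (S.b k) ≡ S'.b m
    ψ-b {k} {m} fw≡w = begin
      to ψ (S.b k)                                   ≡⟨ proj₂ ψ-spec (S.Ua.c-nonTop k) ⟩
      S'.upperProject (to f (S.upperEmbed (S.b k))) ≡⟨ cong (S'.upperProject ∘ to f) (S.upperEmbed-b k) ⟩
      S'.upperProject (to f (S.junction k))         ≡⟨ cong S'.upperProject fw≡w ⟩
      S'.upperProject (S'.junction m)                ≡⟨ S'.upperProject-junction m ⟩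
      S'.b m                                          ∎
      where open ≡-Reasoning

  automorphisms⇒⊑≃⊑ : (φ : S.L._≤_ ≃ S.L._≤_) (ψ : S.U._≤_ ≃ S.U._≤_) →
    (τ : Index → Index) → (∀ k → τ (τ k) ≡ k) →
    (∀ k → to φ (S.c k) ≡ S.c (τ k)) → (∀ k → to ψ (S.b k) ≡ S'.b (τ k)) → S._⊑_ ≃ S'._⊑_
  automorphisms⇒⊑≃⊑ φ ψ τ τ-involutive φ-c ψ-b =
    mk≃ F.map G.map G∘F F∘G (λ {p} {q} → F.map-mono {p} {q}) (λ {p} {q} → G.map-mono {p} {q})
    where
    module F = SumMap L U hc hb hb' φ ψ τ τ-involutive φ-c ψ-b
    module G = SumMap L U hc hb' hb (≃-sym φ) (≃-sym ψ) τ τ-involutive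
                 (λ k → to≡⇒from≡ φ (trans (φ-c (τ k)) (cong S.c (τ-involutive k))))
                 (λ k → to≡⇒from≡ ψ (trans (ψ-b (τ k)) (cong S'.b (τ-involutive k))))

    G∘F : ∀ p → G.map (F.map p) ≡ p
    G∘F (inj₁ (x , _)) = S.inj₁-cong (from-to φ x)
    G∘F (inj₂ (v , _)) = S.inj₂-cong (from-to ψ v)

    F∘G : ∀ q → F.map (G.map q) ≡ q
    F∘G (inj₁ (x , _)) = S'.inj₁-cong (to-from φ x)
    F∘G (inj₂ (v , _)) = S'.inj₂-cong (to-from ψ v)

module _ (L U : FinLattice) {c₁ c₂ : Elt L} (hc : ExactlyTwoCoatoms L c₁ c₂)
         {a₁ a₂ : Elt U} (ha : ExactlyTwoAtoms U a₁ a₂) where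
  private
    module S₁ = TwoSum L U hc ha
    module S₂ = TwoSum L U hc (swapAtoms U ha)

  ≅⇔⊑≃⊑ : (VSum._≤_ L U c₁ c₂ a₁ a₂ ≅ VSum._≤_ L U c₁ c₂ a₂ a₁) ⇔ (S₁._⊑_ ≃ S₂._⊑_)
  ≅⇔⊑≃⊑ = mk⇔
    (≃-cong (λ {p} {q} → S₁.≤ˢ⇔⊑ {p} {q}) (λ {p} {q} → S₂.≤ˢ⇔⊑ {p} {q}) ∘ ≅⇒≃)
    (≃⇒≅ ∘ ≃-cong (λ {p} {q} → ⇔-sym (S₁.≤ˢ⇔⊑ {p} {q})) (λ {p} {q} → ⇔-sym (S₂.≤ˢ⇔⊑ {p} {q})))

  symmetricCoatoms⇒⊑≃⊑ : Symmetric L c₁ c₂ → S₁._⊑_ ≃ S₂._⊑_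
  symmetricCoatoms⇒⊑≃⊑ (φ , φc₁ , φc₂) =
    automorphisms⇒⊑≃⊑ L U hc ha (swapAtoms U ha) (≅⇒≃ φ) ≃-refl swap swap-involutive
      (λ { ι₁ → φc₁ ; ι₂ → φc₂ }) (λ { ι₁ → refl ; ι₂ → refl })

  symmetricAtoms⇒⊑≃⊑ : Symmetric U a₁ a₂ → S₁._⊑_ ≃ S₂._⊑_
  symmetricAtoms⇒⊑≃⊑ (ψ , ψa₁ , ψa₂) =
    automorphisms⇒⊑≃⊑ L U hc ha (swapAtoms U ha) ≃-refl (≅⇒≃ ψ) (λ k → k) (λ _ → refl)
      (λ _ → refl) (λ { ι₁ → ψa₁ ; ι₂ → ψa₂ })

  private
    swapped₁₂ : ∀ k → S₁.b k ≡ S₂.b (swap k)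
    swapped₁₂ ι₁ = refl
    swapped₁₂ ι₂ = refl

    swapped₂₁ : ∀ k → S₂.b k ≡ S₁.b (swap k)
    swapped₂₁ ι₁ = refl
    swapped₂₁ ι₂ = refl

    preserved : (f : S₁._⊑_ ≃ S₂._⊑_) → ∀ i → ∃[ m ] to f (S₁.junction i) ≡ S₂.junction m
    preserved = junctions-preserved L U hc ha (swapAtoms U ha) swapped₁₂

    preserved⁻ : (f : S₁._⊑_ ≃ S₂._⊑_) → ∀ i → ∃[ m ] from f (S₂.junction i) ≡ S₁.junction m
    preserved⁻ f = junctions-preserved L U hc (swapAtoms U ha) ha swapped₂₁ (≃-sym f)

    junction-images-distinct : (f : S₁._⊑_ ≃ S₂._⊑_) → ∀ {m} →
      to f (S₁.junction ι₁) ≡ S₂.junction m → to f (S₁.junction ι₂) ≡ S₂.junction m → ⊥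
    junction-images-distinct f e₁ e₂ =
      proj₁ hc (cong S₁.lowerProject (to-injective f (trans e₁ (sym e₂))))

  ⊑≃⊑⇒symmetric : S₁._⊑_ ≃ S₂._⊑_ → Symmetric L c₁ c₂ ⊎ Symmetric U a₁ a₂
  ⊑≃⊑⇒symmetric f with preserved f ι₁ | preserved f ι₂
  ... | ι₁ , e₁ | ι₁ , e₂ = ⊥-elim (junction-images-distinct f e₁ e₂)
  ... | ι₂ , e₁ | ι₂ , e₂ = ⊥-elim (junction-images-distinct f e₁ e₂)
  ... | ι₂ , e₁ | ι₁ , e₂ =
    let φ , φ-c = lowerAutomorphism L U hc ha (swapAtoms U ha) f (preserved f) (preserved⁻ f)
    in inj₁ (≃⇒≅ φ , φ-c e₁ , φ-c e₂)
  ... | ι₁ , e₁ | ι₂ , e₂ =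
    let ψ , ψ-b = upperAutomorphism L U hc ha (swapAtoms U ha) f (preserved f) (preserved⁻ f)
    in inj₂ (≃⇒≅ ψ , ψ-b e₁ , ψ-b e₂)

lemma1 : (L U : FinLattice)
    → LengthAtLeast3 L → LengthAtLeast3 U
    → (c₁ c₂ : Elt L) → ExactlyTwoCoatoms L c₁ c₂
    → (a₁ a₂ : Elt U) → ExactlyTwoAtoms U a₁ a₂
    → (¬ (VSum._≤_ L U c₁ c₂ a₁ a₂ ≅ VSum._≤_ L U c₁ c₂ a₂ a₁))
      ⇔ (Fixed L c₁ c₂ × Fixed U a₁ a₂)
lemma1 L U _ _ c₁ c₂ hc a₁ a₂ ha = mk⇔
  (λ ¬iso → ¬iso ∘ ⊑≃⊑⇒≅ ∘ symmetricCoatoms⇒⊑≃⊑ L U hc ha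
          , ¬iso ∘ ⊑≃⊑⇒≅ ∘ symmetricAtoms⇒⊑≃⊑ L U hc ha)
  (λ (fixed-c , fixed-a) → Sum.[ fixed-c , fixed-a ] ∘ ⊑≃⊑⇒symmetric L U hc ha ∘ ≅⇒⊑≃⊑)
  where open Equivalence (≅⇔⊑≃⊑ L U hc ha) using () renaming (to to ≅⇒⊑≃⊑; from to ⊑≃⊑⇒≅)
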